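{- Let $C$ be a dendritic face complex with greatest element $\omega$, $n=\dim\omega$, and let $0\le k\le n$. Then $\gamma^{(k)}\omega$ is not a source: there is no $c\in C$ with $\gamma^{(k)}\omega\prec^-c$.
   Context: A positive-to-one poset (POP) is a finite set $P$ with $\dim:P\to\mathbb{N}$ and binary relations $\prec^-,\prec^+$; $y\prec x$ means $y\prec^-x$ or $y\prec^+x$. Axioms: $y\prec x\Rightarrow\dim x=\dim y+1$; never both $y\prec^-x$ and $y\prec^+x$; every $x$ with $\dim x\ge1$ has exactly one $y$ with $y\prec^+x$, denoted $\gamma(x)$, and at least one $y$ with $y\prec^-x$. $\delta(x)=\{y:y\prec^-x\}$; $\le$ is the reflexive-transitive closure of $\prec$. A dendritic face complex is a POP such that: it has a greatest element for $\le$; (oriented thinness) whenever $z\prec^{\beta}y\prec^{\alpha}x$ there is a unique $y'\ne y$ with $z\prec y'\prec x$, and writing $z\prec^{\beta'}y'\prec^{\alpha'}x$ the signs (as $\pm1$) satisfy $\alpha\beta=-\alpha'\beta'$; (acyclicity) $\delta(x)$ is a singleton if $\dim x=1$, nonempty if $\dim x\ge1$, and for $\dim x\ge1$ there are no $p\ge1$, $y_1,\dots,y_p\in\delta(x)$ with $\gamma(y_{i+1})\in\delta(y_i)$ ($1\le i<p$) and $\gamma(y_1)\in\delta(y_p)$. For $0\le k\le n$, $\gamma^{(k)}\omega:=\gamma^{n-k}(\omega)$. -}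

module Defs where

open import Data.Nat using (ℕ; zero; suc; _≤_; _<_; _∸_; s≤s)
open import Data.Nat.Properties using (≤∧≢⇒<; ≤-pred)
import Data.Nat as ℕ
open import Data.Fin using (Fin; toℕ; fromℕ<)
open import Data.Fin.Properties using (toℕ<n)
open import Data.Product using (Σ; ∃; _×_; _,_)
open import Data.Empty using (⊥)
open import Relation.Nullary using (¬_; yes; no)
open import Relation.Binary.PropositionalEquality using (_≡_; _≢_)
open import Relation.Binary.Construct.Closure.ReflexiveTransitive using (Star)

data Sign : Set where
  minus plus : Sign

_·_ : Sign → Sign → Sign
minus · minus = plus
minus · plus  = minus
plus  · s     = s

negate : Sign → Sign
negate minus = plus
negate plus  = minus

csuc : ∀ {p} → Fin (suc p) → Fin (suc p)
csuc {p} i with toℕ i ℕ.≟ p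
... | yes _ = Fin.zero
... | no ne = fromℕ< (s≤s (≤∧≢⇒< (≤-pred (toℕ<n i)) ne))

record POP (N : ℕ) : Set₁ where
  field
    dim : Fin N → ℕ
    face : Sign → Fin N → Fin N → Set

  _≺⁻_ : Fin N → Fin N → Set
  y ≺⁻ x = face minus y x

  _≺⁺_ : Fin N → Fin N → Set
  y ≺⁺ x = face plus y x

  _≺_ : Fin N → Fin N → Set
  y ≺ x = Σ Sign λ α → face α y x

  _≤C_ : Fin N → Fin N → Set
  _≤C_ = Star _≺_

  field
    dim-≺ : ∀ {x y} → y ≺ x → dim x ≡ suc (dim y)
    not-both : ∀ {x y} → y ≺⁻ x → y ≺⁺ x → ⊥
    γ-exists : ∀ x → 1 ≤ dim x → Σ (Fin N) λ y → y ≺⁺ x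
    γ-unique : ∀ {x y y'} → y ≺⁺ x → y' ≺⁺ x → y ≡ y'
    δ-nonempty : ∀ x → 1 ≤ dim x → Σ (Fin N) λ y → y ≺⁻ x

  -- "γ(y) ∈ δ(x)", written out via the unique positive face of y
  γ∈δ : Fin N → Fin N → Set
  γ∈δ y x = Σ (Fin N) λ w → (w ≺⁺ y) × (w ≺⁻ x)

  -- IsGammaIter m x y  :  y = γ^m(x)
  data IsGammaIter : ℕ → Fin N → Fin N → Set where
    γ0 : ∀ {x} → IsGammaIter 0 x x
    γs : ∀ {m x y z} → IsGammaIter m x z → y ≺⁺ z → IsGammaIter (suc m) x y

record DendriticFaceComplex (N : ℕ) : Set₁ where
  field
    pop : POP N
  open POP pop public
  field
    ω : Fin N
    ω-greatest : ∀ x → x ≤C ω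
    thin : ∀ {α β x y z} → face β z y → face α y x →
      Σ (Fin N) λ y' → (y' ≢ y) × (z ≺ y') × (y' ≺ x)
        × (∀ y'' → y'' ≢ y → z ≺ y'' → y'' ≺ x → y'' ≡ y')
        × (∀ α' β' → face β' z y' → face α' y' x → α · β ≡ negate (α' · β'))
    δ-singleton : ∀ x → dim x ≡ 1 →
      Σ (Fin N) λ y → (y ≺⁻ x) × (∀ y' → y' ≺⁻ x → y' ≡ y)
    no-cycle : ∀ x → 1 ≤ dim x → ∀ p (ys : Fin (suc p) → Fin N) →
      (∀ i → ys i ≺⁻ x) → ¬ (∀ i → γ∈δ (ys (csuc i)) (ys i))

  n : ℕ
  n = dim ω

{-# OPTIONS --safe #-}
-- Write z = γ^m(x) and suppose z ≺⁻ c ≤ x; we argue by induction on m.  For m = 0 dimension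
-- counting is contradictory; for m = 1 it forces c = x, against z ≺⁺ x.  For m ≥ 2 induction
-- excludes c ≤ γ(x), so c lies below an input g of x.  If m = 2 then c = g, and the two paths
-- z ≺⁺ γ(x) ≺⁺ x and z ≺⁻ g ≺⁻ x violate oriented thinness.  If m ≥ 3, oriented thinness turns g
-- into another input g' of x with γ(g') ∈ δ(g) and again z ≺⁻ c' ≤ g' for some c'.  Iterating
-- yields an infinite chain in δ(x), which in a finite complex closes up into a cycle forbidden by
-- acyclicity.
module Submission where

open import Defs
open import Data.Nat using (ℕ; zero; suc; _≟_; _+_; _≤_; _<_; _∸_; z≤n; s≤s)
open import Data.Nat.Properties using (<-irrefl; suc-injective; +-suc; +-identityʳ; n<1+n; m≤n+m; m≤n⇒∃[o]m+o≡n; ≤-refl; ≤-reflexive; ≤-trans; <⇒≤; <-≤-trans; ≤-<-trans; ≤∧≢⇒<; ≤-pred)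
open import Data.Fin using (Fin; toℕ)
open import Data.Fin.Properties using (toℕ<n; toℕ-fromℕ<; pigeonhole)
open import Data.Product using (Σ; ∃; _×_; _,_; proj₁; proj₂)
open import Data.Sum using (_⊎_; inj₁; inj₂)
open import Data.Empty using (⊥; ⊥-elim)
open import Function using (_∘_)
open import Relation.Nullary using (¬_; yes; no)
open import Relation.Binary using (Rel)
open import Relation.Binary.PropositionalEquality using (_≡_; _≢_; refl; sym; trans; cong; subst; module ≡-Reasoning)
open import Relation.Binary.Construct.Closure.ReflexiveTransitive using (Star; ε; _◅_; _◅◅_; return)

negate[minus·β]≡β : ∀ β → negate (minus · β) ≡ β
negate[minus·β]≡β minus = refl
negate[minus·β]≡β plus  = refl

toℕ-csuc : ∀ {p} (i : Fin (suc p)) → (toℕ i ≡ p × toℕ (csuc i) ≡ 0) ⊎ toℕ (csuc i) ≡ suc (toℕ i)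
toℕ-csuc {p} i with toℕ i ≟ p
... | yes i≡p = inj₁ (i≡p , refl)
... | no  i≢p = inj₂ (toℕ-fromℕ< (s≤s (≤∧≢⇒< (≤-pred (toℕ<n i)) i≢p)))

sequence-cycle : ∀ {N ℓ} (R : Rel (Fin N) ℓ) (f : ℕ → Fin N) → (∀ t → R (f (suc t)) (f t)) →
  Σ ℕ λ p → Σ (Fin (suc p) → ℕ) λ ts → ∀ i → R (f (ts (csuc i))) (f (ts i))
sequence-cycle {N} R f step with pigeonhole (n<1+n N) (f ∘ toℕ)
... | i , j , i<j , fi≡fj with m≤n⇒∃[o]m+o≡n i<j
...   | d , 1+i+d≡j = d , (λ l → toℕ i + toℕ l) , λ l → subst (λ y → R y (f (toℕ i + toℕ l))) (sym (next l)) (step _)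
  where
  open ≡-Reasoning
  next : ∀ l → f (toℕ i + toℕ (csuc l)) ≡ f (suc (toℕ i + toℕ l))
  next l with toℕ-csuc l
  ... | inj₂ csuc-l≡1+l = cong f (trans (cong (toℕ i +_) csuc-l≡1+l) (+-suc (toℕ i) (toℕ l)))
  ... | inj₁ (l≡d , csuc-l≡0) = begin
    f (toℕ i + toℕ (csuc l))  ≡⟨ cong (λ k → f (toℕ i + k)) csuc-l≡0 ⟩
    f (toℕ i + 0)             ≡⟨ cong f (+-identityʳ (toℕ i)) ⟩
    f (toℕ i)                 ≡⟨ fi≡fj ⟩
    f (toℕ j)                 ≡⟨ cong f (sym 1+i+d≡j) ⟩
    f (suc (toℕ i + d))       ≡⟨ cong (λ k → f (suc (toℕ i + k))) (sym l≡d) ⟩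
    f (suc (toℕ i + toℕ l))   ∎

Star-unsnoc : ∀ {a ℓ} {A : Set a} {R : Rel A ℓ} {x y} → Star R x y → x ≡ y ⊎ ∃ λ w → Star R x w × R w y
Star-unsnoc ε = inj₁ refl
Star-unsnoc (r ◅ rs) with Star-unsnoc rs
... | inj₁ refl            = inj₂ (_ , ε , r)
... | inj₂ (w , rs′ , r′)  = inj₂ (w , r ◅ rs′ , r′)

module POPProperties {N} (P : POP N) where
  open POP P

  _≺⁻≤_ : Rel (Fin N) _
  z ≺⁻≤ g = ∃ λ c → z ≺⁻ c × c ≤C g

  ≺-dim : ∀ {y x} → y ≺ x → dim y < dim x
  ≺-dim y≺x = ≤-reflexive (sym (dim-≺ y≺x))

  ≤C-dim : ∀ {c x} → c ≤C x → dim c ≤ dim x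
  ≤C-dim ε = ≤-refl
  ≤C-dim (c≺y ◅ y≤x) = <⇒≤ (<-≤-trans (≺-dim c≺y) (≤C-dim y≤x))

  ≤C-≺-dim : ∀ {c h x} → c ≤C h → h ≺ x → dim c < dim x
  ≤C-≺-dim c≤h h≺x = ≤-<-trans (≤C-dim c≤h) (≺-dim h≺x)

  sibling-dim : ∀ {x y y′} → y ≺ x → y′ ≺ x → dim y ≡ dim y′
  sibling-dim y≺x y′≺x = suc-injective (trans (sym (dim-≺ y≺x)) (dim-≺ y′≺x))

  IsGammaIter-dim : ∀ {m x y} → IsGammaIter m x y → dim x ≡ m + dim y
  IsGammaIter-dim γ0 = refl
  IsGammaIter-dim {suc m} {y = y} (γs it y≺⁺w) =
    trans (IsGammaIter-dim it) (trans (cong (m +_) (dim-≺ (plus , y≺⁺w))) (+-suc m (dim y)))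

  IsGammaIter-1+-dim : ∀ {m x y} → IsGammaIter (suc m) x y → dim y < dim x
  IsGammaIter-1+-dim {m} {y = y} it = subst (dim y <_) (sym (IsGammaIter-dim it)) (s≤s (m≤n+m (dim y) m))

  IsGammaIter-uncons : ∀ {m x y} → IsGammaIter (suc m) x y → ∃ λ x₁ → x₁ ≺⁺ x × IsGammaIter m x₁ y
  IsGammaIter-uncons (γs γ0 y≺⁺x) = _ , y≺⁺x , γ0
  IsGammaIter-uncons (γs it@(γs _ _) y≺⁺w) with IsGammaIter-uncons it
  ... | x₁ , x₁≺⁺x , it₁ = x₁ , x₁≺⁺x , γs it₁ y≺⁺w

  ≺⁻≤-≺-trans : ∀ {z s y} → z ≺⁻≤ s → s ≺ y → z ≺⁻≤ y
  ≺⁻≤-≺-trans (c , z≺⁻c , c≤s) s≺y = c , z≺⁻c , c≤s ◅◅ return s≺y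

  ≺⁻≤-dim : ∀ {z g} → z ≺⁻≤ g → dim z < dim g
  ≺⁻≤-dim {g = g} (c , z≺⁻c , c≤g) = subst (_≤ dim g) (dim-≺ (minus , z≺⁻c)) (≤C-dim c≤g)

  ≺⁻≤-codim-1 : ∀ {z g} → z ≺⁻≤ g → dim g ≡ suc (dim z) → z ≺⁻ g
  ≺⁻≤-codim-1 (c , z≺⁻c , c≤g) g-codim with Star-unsnoc c≤g
  ... | inj₁ refl = z≺⁻c
  ... | inj₂ (h , c≤h , h≺g) = ⊥-elim (<-irrefl (trans (dim-≺ (minus , z≺⁻c)) (sym g-codim)) (≤C-≺-dim c≤h h≺g))

  ≺⁻≤-through-face : ∀ {z g} → z ≺⁻≤ g → suc (dim z) < dim g → ∃ λ h → z ≺⁻≤ h × h ≺ g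
  ≺⁻≤-through-face (c , z≺⁻c , c≤g) g-codim with Star-unsnoc c≤g
  ... | inj₁ refl = ⊥-elim (<-irrefl (sym (dim-≺ (minus , z≺⁻c))) g-codim)
  ... | inj₂ (h , c≤h , h≺g) = h , (c , z≺⁻c , c≤h) , h≺g

module DendriticFaceComplexProperties {N} (C : DendriticFaceComplex N) where
  open DendriticFaceComplex C
  open POPProperties pop

  thin-sign : ∀ {α β α′ β′ x y y′ z} → face β z y → face α y x → face β′ z y′ → face α′ y′ x → y′ ≢ y →
    α · β ≡ negate (α′ · β′)
  thin-sign z≺y y≺x z≺y′ y′≺x y′≢y with thin z≺y y≺x
  ... | _ , _ , _ , _ , unique , sign with unique _ y′≢y (_ , z≺y′) (_ , y′≺x)
  ...   | refl = sign _ _ z≺y′ y′≺x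

  γ-face⇒δ-face : ∀ {β t s g} → face β t s → s ≺⁺ g → ∃ λ r → face β t r × r ≺⁻ g
  γ-face⇒δ-face t≺s s≺⁺g with thin t≺s s≺⁺g
  ... | r , r≢s , _ , (plus , r≺⁺g) , _ = ⊥-elim (r≢s (γ-unique r≺⁺g s≺⁺g))
  ... | r , _ , (β′ , t≺r) , (minus , r≺⁻g) , _ , sign =
    r , subst (λ σ → face σ _ r) (sym (trans (sign minus β′ t≺r r≺⁻g) (negate[minus·β]≡β β′))) t≺r , r≺⁻g

  input-of-input : ∀ {s g x} → s ≺⁻ g → g ≺⁻ x → ∃ λ y → (s ≺ y × y ≺⁺ x) ⊎ (s ≺⁺ y × y ≺⁻ x)
  input-of-input s≺⁻g g≺⁻x with thin s≺⁻g g≺⁻x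
  ... | y , _ , s≺y , (plus , y≺⁺x) , _ = y , inj₁ (s≺y , y≺⁺x)
  ... | y , _ , (plus , s≺⁺y) , (minus , y≺⁻x) , _ = y , inj₂ (s≺⁺y , y≺⁻x)
  ... | y , _ , (minus , s≺⁻y) , (minus , y≺⁻x) , _ , sign with sign minus minus s≺⁻y y≺⁻x
  ...   | ()

  γγ-not-δδ : ∀ {x x₁ z h} → z ≺⁺ x₁ → x₁ ≺⁺ x → z ≺⁻ h → h ≺⁻ x → ⊥
  γγ-not-δδ z≺⁺x₁ x₁≺⁺x z≺⁻h h≺⁻x with thin-sign z≺⁺x₁ x₁≺⁺x z≺⁻h h≺⁻x (λ { refl → not-both h≺⁻x x₁≺⁺x })
  ... | ()

  ≺⁻≤-γ⇒δ : ∀ {z s g} → z ≺⁻≤ s → s ≺⁺ g → ∃ λ r → z ≺⁻≤ r × r ≺⁻ g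
  ≺⁻≤-γ⇒δ (c , z≺⁻c , c≤s) s≺⁺g with Star-unsnoc c≤s
  ... | inj₁ refl with γ-face⇒δ-face z≺⁻c s≺⁺g
  ...   | r , z≺⁻r , r≺⁻g = r , (r , z≺⁻r , ε) , r≺⁻g
  ≺⁻≤-γ⇒δ (c , z≺⁻c , c≤s) s≺⁺g | inj₂ (t , c≤t , (β , t≺s)) with γ-face⇒δ-face t≺s s≺⁺g
  ...   | r , t≺r , r≺⁻g = r , (c , z≺⁻c , c≤t ◅◅ return (β , t≺r)) , r≺⁻g

  ≺⁻≤-through-input : ∀ {z g} → z ≺⁻≤ g → suc (dim z) < dim g → ∃ λ r → z ≺⁻≤ r × r ≺⁻ g
  ≺⁻≤-through-input z≺⁻≤g g-codim with ≺⁻≤-through-face z≺⁻≤g g-codim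
  ... | s , z≺⁻≤s , (minus , s≺⁻g) = s , z≺⁻≤s , s≺⁻g
  ... | s , z≺⁻≤s , (plus , s≺⁺g) = ≺⁻≤-γ⇒δ z≺⁻≤s s≺⁺g

  no-infinite-δ-descent : ∀ {x} (P : Fin N → Set) → (∀ {g} → P g → g ≺⁻ x) →
    (∀ {g} → P g → ∃ λ g′ → P g′ × γ∈δ g′ g) → ∀ {g} → ¬ P g
  no-infinite-δ-descent {x} P P⇒δ descend {g} Pg =
    let p , ts , cycle = sequence-cycle γ∈δ (proj₁ ∘ walk) (proj₂ ∘ proj₂ ∘ descend ∘ proj₂ ∘ walk)
    in no-cycle x (≤-trans (s≤s z≤n) (≺-dim (minus , P⇒δ Pg))) p (proj₁ ∘ walk ∘ ts) (P⇒δ ∘ proj₂ ∘ walk ∘ ts) cycle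
    where
    walk : ℕ → Σ (Fin N) P
    walk zero    = g , Pg
    walk (suc t) = let g′ , Pg′ , _ = descend (proj₂ (walk t)) in g′ , Pg′

  δ-descent-step : ∀ {x x₁ z g} → x₁ ≺⁺ x → ¬ (z ≺⁻≤ x₁) → suc (dim z) < dim x₁ →
    g ≺⁻ x → z ≺⁻≤ g → ∃ λ g′ → (g′ ≺⁻ x × z ≺⁻≤ g′) × γ∈δ g′ g
  δ-descent-step {z = z} x₁≺⁺x z⋠x₁ x₁-codim g≺⁻x z≺⁻≤g
    with ≺⁻≤-through-input z≺⁻≤g (subst (suc (dim z) <_) (sibling-dim (plus , x₁≺⁺x) (minus , g≺⁻x)) x₁-codim)
  ... | s , z≺⁻≤s , s≺⁻g with input-of-input s≺⁻g g≺⁻x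
  ...   | y , inj₁ (s≺y , y≺⁺x) = ⊥-elim (z⋠x₁ (subst (z ≺⁻≤_) (γ-unique y≺⁺x x₁≺⁺x) (≺⁻≤-≺-trans z≺⁻≤s s≺y)))
  ...   | y , inj₂ (s≺⁺y , y≺⁻x) = y , (y≺⁻x , ≺⁻≤-≺-trans z≺⁻≤s (plus , s≺⁺y)) , (s , s≺⁺y , s≺⁻g)

  not-≺⁻≤-δ : ∀ m {x x₁ z h} → x₁ ≺⁺ x → IsGammaIter (suc m) x₁ z → ¬ (z ≺⁻≤ x₁) → h ≺⁻ x → ¬ (z ≺⁻≤ h)
  not-≺⁻≤-δ zero {z = z} {h} x₁≺⁺x (γs γ0 z≺⁺x₁) _ h≺⁻x z≺⁻≤h =
    γγ-not-δδ z≺⁺x₁ x₁≺⁺x (≺⁻≤-codim-1 z≺⁻≤h h-codim) h≺⁻x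
    where
    h-codim : dim h ≡ suc (dim z)
    h-codim = trans (sibling-dim (minus , h≺⁻x) (plus , x₁≺⁺x)) (dim-≺ (plus , z≺⁺x₁))
  not-≺⁻≤-δ (suc m) {x} {x₁} {z} x₁≺⁺x (γs it z≺⁺w) z⋠x₁ h≺⁻x z≺⁻≤h =
    no-infinite-δ-descent (λ g → g ≺⁻ x × z ≺⁻≤ g) proj₁
      (λ (g≺⁻x , z≺⁻≤g) → δ-descent-step x₁≺⁺x z⋠x₁ x₁-codim g≺⁻x z≺⁻≤g)
      (h≺⁻x , z≺⁻≤h)
    where
    x₁-codim : suc (dim z) < dim x₁
    x₁-codim = ≤-trans (s≤s (≺-dim (plus , z≺⁺w))) (IsGammaIter-1+-dim it)

  not-≺⁻≤-via-γ : ∀ m {x x₁ z} → x₁ ≺⁺ x → IsGammaIter (suc m) x₁ z → ¬ (z ≺⁻≤ x₁) → ¬ (z ≺⁻≤ x)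
  not-≺⁻≤-via-γ m {z = z} x₁≺⁺x it₁ z⋠x₁ z≺⁻≤x
    with ≺⁻≤-through-face z≺⁻≤x (<-≤-trans (s≤s (IsGammaIter-1+-dim it₁)) (≺-dim (plus , x₁≺⁺x)))
  ... | h , z≺⁻≤h , (plus , h≺⁺x) = z⋠x₁ (subst (z ≺⁻≤_) (γ-unique h≺⁺x x₁≺⁺x) z≺⁻≤h)
  ... | h , z≺⁻≤h , (minus , h≺⁻x) = not-≺⁻≤-δ m x₁≺⁺x it₁ z⋠x₁ h≺⁻x z≺⁻≤h

  γ-iterate-not-≺⁻≤ : ∀ m {x z} → IsGammaIter m x z → ¬ (z ≺⁻≤ x)
  γ-iterate-not-≺⁻≤ zero γ0 z≺⁻≤z = <-irrefl refl (≺⁻≤-dim z≺⁻≤z)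
  γ-iterate-not-≺⁻≤ (suc zero) (γs γ0 z≺⁺x) z≺⁻≤x = not-both (≺⁻≤-codim-1 z≺⁻≤x (dim-≺ (plus , z≺⁺x))) z≺⁺x
  γ-iterate-not-≺⁻≤ (suc (suc m)) it =
    let x₁ , x₁≺⁺x , it₁ = IsGammaIter-uncons it
    in not-≺⁻≤-via-γ m x₁≺⁺x it₁ (γ-iterate-not-≺⁻≤ (suc m) it₁)

mainTheorem20 : ∀ {N} (C : DendriticFaceComplex N) (k : ℕ) → k ≤ DendriticFaceComplex.n C →
    ∀ (g : Fin N) → DendriticFaceComplex.IsGammaIter C (DendriticFaceComplex.n C ∸ k) (DendriticFaceComplex.ω C) g →
    ¬ (Σ (Fin N) λ c → DendriticFaceComplex._≺⁻_ C g c)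
mainTheorem20 C k _ g it (c , g≺⁻c) = γ-iterate-not-≺⁻≤ _ it (c , g≺⁻c , ω-greatest c)
  where
  open DendriticFaceComplex C
  open DendriticFaceComplexProperties C
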